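{- For all ${\sf FIL}$-formulas $A,B$: ${\sf FIL}\vdash A\rhd B\to A\rhd(B\wedge\Box\neg A)$ (the principle $\mathsf W$).
   Context: The logic ${\sf FIL}$: the language has propositional variables, interpretation variables $k_0,k_1,\dots$, one interpretation constant ${\sf id}$, $\top,\bot$, Boolean connectives and modalities $\Box^{\mathfrak a}A$, $A\rhd^{\mathfrak a}B$ where $\mathfrak a$ is a finite sequence of interpretation terms without repetition; unlabelled $\Box,\rhd$ stand for label ${\sf id}$ / the empty sequence; $\Diamond^{\mathfrak a}:=\neg\Box^{\mathfrak a}\neg$; $\mathfrak a,k$ is $\mathfrak a$ extended by $k$. Sequents $\Gamma\vdash C$ with $\Gamma$ a multiset, with $\Gamma,\Delta\vdash C$ iff $\Delta\vdash\bigwedge\Gamma\to C$. Axioms/rules (for all labels $\mathfrak a,\mathfrak b$, terms $k$): all tautologies; modus ponens; $\Box^{\mathfrak a}(A\to B)\to(\Box^{\mathfrak a}A\to\Box^{\mathfrak a}B)$; $\Box^{\mathfrak b}A\to\Box^{\mathfrak a}\Box^{\mathfrak b}A$; $\Box^{\mathfrak a}(\Box^{\mathfrak a}A\to A)\to\Box^{\mathfrak a}A$; $\Box^{\mathfrak a}(A\to B)\to A\rhd^{\mathfrak a}B$; $(A\rhd B)\wedge(B\rhd^{\mathfrak a}C)\to A\rhd^{\mathfrak a}C$; $(A\rhd^{\mathfrak a}B)\wedge\Box^{\mathfrak a}(B\to C)\to A\rhd^{\mathfrak a}C$; $(A\rhd^{\mathfrak a}C)\wedge(B\rhd^{\mathfrak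 a}C)\to A\vee B\rhd^{\mathfrak a}C$; $A\rhd^{\mathfrak a}B\to(\Diamond A\to\Diamond^{\mathfrak a}B)$; $A\rhd^{\mathfrak a}\Diamond^{\mathfrak b}B\to A\rhd^{\mathfrak b}B$; $\Box^{\mathfrak a,k}A\to\Box^{\mathfrak a}A$; $A\rhd^{\mathfrak a}B\to A\rhd^{\mathfrak a,k}B$; necessitation $\vdash A\Rightarrow\vdash\Box^{\mathfrak a}A$; rule $\mathsf P^{\mathfrak a,\mathfrak b,k}$: from $\Gamma,\Delta,\Box^{\mathfrak b}(A\rhd^{\mathfrak a,k}B)\vdash C$ infer $\Gamma,A\rhd^{\mathfrak a}B\vdash C$, provided $k$ is an interpretation variable not occurring in $\mathfrak a,\Gamma,A,B,C$ and $\Delta$ consists of formulas of the forms $E\rhd^{\mathfrak a,k}F\to E\rhd^{\mathfrak a}F$ and $\Box^{\mathfrak a}E\to\Box^{\mathfrak a,k}E$. -}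

module Defs where

open import Data.Nat using (ℕ)
open import Data.Bool using (Bool; true; false; not; _∧_; _∨_)
open import Data.Empty using (⊥)
open import Data.Unit using (⊤; tt)
open import Data.Sum using (_⊎_)
open import Data.Product using (_×_; _,_)
open import Data.List using (List; []; _∷_; _++_)
open import Data.List.Relation.Unary.All using (All)
open import Relation.Nullary using (¬_)
open import Relation.Binary.PropositionalEquality using (_≡_)

-- Interpretation terms: variables k₀,k₁,… and the constant id

data Term : Set where
  kv : ℕ → Term
  idt : Term

-- Finite sequences of terms (snoc lists, matching the notation 𝔞,k)

data Seq : Set where
  ε   : Seq
  _▸_ : Seq → Term → Seq

_∈ˢ_ : Term → Seq → Set
t ∈ˢ ε       = ⊥
t ∈ˢ (a ▸ s) = t ∈ˢ a ⊎ t ≡ s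

NoRep : Seq → Set
NoRep ε       = ⊤
NoRep (a ▸ t) = NoRep a × ¬ (t ∈ˢ a)

-- Labels: sequences without repetition (the proof is irrelevant, so
-- labels with the same sequence are definitionally equal)
record Label : Set where
  constructor lab
  field
    seq : Seq
    .norep : NoRep seq
open Label public

∅ : Label
∅ = lab ε tt

ext : (a : Label) (k : Term) → .(¬ (k ∈ˢ seq a)) → Label
ext (lab s p) k q = lab (s ▸ k) (p , q)

infixr 6 _∧'_
infixr 5 _∨'_
infixr 4 _⇒_

data Fm : Set where
  pv    : ℕ → Fm
  ⊤' ⊥' : Fm
  ¬'_   : Fm → Fm
  _∧'_ _∨'_ _⇒_ : Fm → Fm → Fm
  □⟨_⟩_   : Label → Fm → Fm
  _▷⟨_⟩_  : Fm → Label → Fm → Fm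

◇⟨_⟩_ : Label → Fm → Fm
◇⟨ a ⟩ A = ¬' (□⟨ a ⟩ (¬' A))

□_ : Fm → Fm
□ A = □⟨ ∅ ⟩ A

◇_ : Fm → Fm
◇ A = ◇⟨ ∅ ⟩ A

_▷_ : Fm → Fm → Fm
A ▷ B = A ▷⟨ ∅ ⟩ B

OccS : ℕ → Seq → Set
OccS n s = kv n ∈ˢ s

Occ : ℕ → Fm → Set
Occ n (pv _)       = ⊥
Occ n ⊤'           = ⊥
Occ n ⊥'           = ⊥
Occ n (¬' A)       = Occ n A
Occ n (A ∧' B)     = Occ n A ⊎ Occ n B
Occ n (A ∨' B)     = Occ n A ⊎ Occ n B
Occ n (A ⇒ B)      = Occ n A ⊎ Occ n B
Occ n (□⟨ a ⟩ A)   = OccS n (seq a) ⊎ Occ n A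
Occ n (A ▷⟨ a ⟩ B) = OccS n (seq a) ⊎ (Occ n A ⊎ Occ n B)

eval : (Fm → Bool) → Fm → Bool
eval v (pv n)       = v (pv n)
eval v ⊤'           = true
eval v ⊥'           = false
eval v (¬' A)       = not (eval v A)
eval v (A ∧' B)     = eval v A ∧ eval v B
eval v (A ∨' B)     = eval v A ∨ eval v B
eval v (A ⇒ B)      = not (eval v A) ∨ eval v B
eval v (□⟨ a ⟩ A)   = v (□⟨ a ⟩ A)
eval v (A ▷⟨ a ⟩ B) = v (A ▷⟨ a ⟩ B)

Taut : Fm → Set
Taut A = (v : Fm → Bool) → eval v A ≡ true

-- Sequents: Γ ⊢ C abbreviates ⊢ ⋀Γ → C

⋀ : List Fm → Fm
⋀ []       = ⊤'
⋀ (A ∷ Γ)  = A ∧' ⋀ Γ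

data PSide (a : Label) (k : ℕ) .(fr : ¬ OccS k (seq a)) : Fm → Set where
  side▷ : ∀ E F → PSide a k fr ((E ▷⟨ ext a (kv k) fr ⟩ F) ⇒ (E ▷⟨ a ⟩ F))
  side□ : ∀ E   → PSide a k fr ((□⟨ a ⟩ E) ⇒ (□⟨ ext a (kv k) fr ⟩ E))

infix 2 ⊢_

data ⊢_ : Fm → Set where
  taut : ∀ {A} → Taut A → ⊢ A
  mp   : ∀ {A B} → ⊢ (A ⇒ B) → ⊢ A → ⊢ B
  K    : ∀ a A B → ⊢ (□⟨ a ⟩ (A ⇒ B) ⇒ (□⟨ a ⟩ A ⇒ □⟨ a ⟩ B))
  Four : ∀ a b A → ⊢ (□⟨ b ⟩ A ⇒ □⟨ a ⟩ □⟨ b ⟩ A)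
  Löb  : ∀ a A → ⊢ (□⟨ a ⟩ (□⟨ a ⟩ A ⇒ A) ⇒ □⟨ a ⟩ A)
  J1   : ∀ a A B → ⊢ (□⟨ a ⟩ (A ⇒ B) ⇒ (A ▷⟨ a ⟩ B))
  J2   : ∀ a A B C → ⊢ (((A ▷ B) ∧' (B ▷⟨ a ⟩ C)) ⇒ (A ▷⟨ a ⟩ C))
  J2'  : ∀ a A B C → ⊢ (((A ▷⟨ a ⟩ B) ∧' □⟨ a ⟩ (B ⇒ C)) ⇒ (A ▷⟨ a ⟩ C))
  J3   : ∀ a A B C → ⊢ (((A ▷⟨ a ⟩ C) ∧' (B ▷⟨ a ⟩ C)) ⇒ ((A ∨' B) ▷⟨ a ⟩ C))
  J4   : ∀ a A B → ⊢ ((A ▷⟨ a ⟩ B) ⇒ (◇ A ⇒ ◇⟨ a ⟩ B))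
  J5   : ∀ a b A B → ⊢ ((A ▷⟨ a ⟩ (◇⟨ b ⟩ B)) ⇒ (A ▷⟨ b ⟩ B))
  Mon□ : ∀ a k .(fr : ¬ (k ∈ˢ seq a)) A →
         ⊢ (□⟨ ext a k fr ⟩ A ⇒ □⟨ a ⟩ A)
  Mon▷ : ∀ a k .(fr : ¬ (k ∈ˢ seq a)) A B →
         ⊢ ((A ▷⟨ a ⟩ B) ⇒ (A ▷⟨ ext a k fr ⟩ B))
  nec  : ∀ a {A} → ⊢ A → ⊢ □⟨ a ⟩ A
  P    : ∀ a b (k : ℕ) (Γ Δ : List Fm) (A B C : Fm)
         (fr : ¬ OccS k (seq a)) →
         All (λ G → ¬ Occ k G) Γ → ¬ Occ k A → ¬ Occ k B → ¬ Occ k C →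
         All (PSide a k fr) Δ →
         ⊢ (⋀ (Γ ++ Δ ++ (□⟨ b ⟩ (A ▷⟨ ext a (kv k) fr ⟩ B) ∷ [])) ⇒ C) →
         ⊢ (⋀ (Γ ++ ((A ▷⟨ a ⟩ B) ∷ [])) ⇒ C)

module Submission where

-- Write D = B ∧ □¬A and θ = ◇A → ◇^κ D. Rule P trades the hypothesis A ▷ B for
-- □^κ (A ▷^κ B), where κ = id,k with k fresh, at the price of the side formula
-- A ▷^κ D → A ▷ D. Under A ▷^κ B, □^κ θ implies θ: from ◇A we get ◇^κ B, and a
-- κ-successor satisfying B but not D satisfies ◇A, hence ◇^κ D by θ, so □^κ ¬D
-- fails. Löb's axiom for □^κ thus gives □^κ θ, and splitting B into D and B ∧ ◇A
-- (to which J5 applies) turns this into B ▷^κ D. Composing with A ▷ B gives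
-- A ▷^κ D, and the side formula yields A ▷ D.

open import Defs
open import Data.Bool using (Bool; true; false; T; not; _∧_; _∨_)
open import Data.Bool.Properties using (T-∧; T-≡)
open import Data.Fin using (Fin; zero; suc)
open import Data.List using ([]; _∷_)
open import Data.List.Relation.Unary.All using ([]; _∷_)
open import Data.Nat using (ℕ; zero; suc; _+_; _≤_; _⊔_)
open import Data.Nat.Properties using (≤-refl; m≤n⇒m≤n⊔o; m≤n⇒m≤o⊔n; 1+n≰n)
open import Data.Product using (proj₁; proj₂)
open import Data.Sum using (_⊎_; [_,_]; inj₁; inj₂)
open import Data.Vec using (Vec; []; _∷_; lookup; map)
open import Data.Vec.Properties using (lookup-map)
open import Function using (_∘_)
open import Function.Bundles using (Equivalence)
open import Relation.Nullary using (¬_)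
open import Relation.Binary.PropositionalEquality using (_≡_; refl; sym; trans; cong; cong₂)

open Equivalence using (to)

data Schema (n : ℕ) : Set where
  var : Fin n → Schema n
  ⊤ˢ : Schema n
  ¬ˢ_ : Schema n → Schema n
  _∧ˢ_ _∨ˢ_ _⇒ˢ_ : Schema n → Schema n → Schema n

infixr 6 _∧ˢ_
infixr 5 _∨ˢ_
infixr 4 _⇒ˢ_

p : ∀ {n} → Schema (1 + n)
p = var zero

q : ∀ {n} → Schema (2 + n)
q = var (suc zero)

r : ∀ {n} → Schema (3 + n)
r = var (suc (suc zero))

s : ∀ {n} → Schema (4 + n)
s = var (suc (suc (suc zero)))

t : ∀ {n} → Schema (5 + n)
t = var (suc (suc (suc (suc zero))))

instantiate : ∀ {n} → Schema n → Vec Fm n → Fm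
instantiate (var i)   σ = lookup σ i
instantiate ⊤ˢ        σ = ⊤'
instantiate (¬ˢ φ)    σ = ¬' instantiate φ σ
instantiate (φ ∧ˢ ψ)  σ = instantiate φ σ ∧' instantiate ψ σ
instantiate (φ ∨ˢ ψ)  σ = instantiate φ σ ∨' instantiate ψ σ
instantiate (φ ⇒ˢ ψ)  σ = instantiate φ σ ⇒ instantiate ψ σ

⟦_⟧ᵇ : ∀ {n} → Schema n → Vec Bool n → Bool
⟦ var i ⟧ᵇ   ρ = lookup ρ i
⟦ ⊤ˢ ⟧ᵇ      ρ = true
⟦ ¬ˢ φ ⟧ᵇ    ρ = not (⟦ φ ⟧ᵇ ρ)
⟦ φ ∧ˢ ψ ⟧ᵇ  ρ = ⟦ φ ⟧ᵇ ρ ∧ ⟦ ψ ⟧ᵇ ρ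
⟦ φ ∨ˢ ψ ⟧ᵇ  ρ = ⟦ φ ⟧ᵇ ρ ∨ ⟦ ψ ⟧ᵇ ρ
⟦ φ ⇒ˢ ψ ⟧ᵇ  ρ = not (⟦ φ ⟧ᵇ ρ) ∨ ⟦ ψ ⟧ᵇ ρ

eval-instantiate : ∀ {n} v (φ : Schema n) σ →
                   eval v (instantiate φ σ) ≡ ⟦ φ ⟧ᵇ (map (eval v) σ)
eval-instantiate v (var i)  σ = sym (lookup-map i (eval v) σ)
eval-instantiate v ⊤ˢ       σ = refl
eval-instantiate v (¬ˢ φ)   σ = cong not (eval-instantiate v φ σ)
eval-instantiate v (φ ∧ˢ ψ) σ = cong₂ _∧_ (eval-instantiate v φ σ) (eval-instantiate v ψ σ)
eval-instantiate v (φ ∨ˢ ψ) σ = cong₂ _∨_ (eval-instantiate v φ σ) (eval-instantiate v ψ σ)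
eval-instantiate v (φ ⇒ˢ ψ) σ =
  cong₂ (λ x y → not x ∨ y) (eval-instantiate v φ σ) (eval-instantiate v ψ σ)

allTrue : ∀ n → (Vec Bool n → Bool) → Bool
allTrue zero    f = f []
allTrue (suc n) f = allTrue n (f ∘ (true ∷_)) ∧ allTrue n (f ∘ (false ∷_))

allTrue-sound : ∀ n (f : Vec Bool n → Bool) → T (allTrue n f) → ∀ ρ → T (f ρ)
allTrue-sound zero    f all []          = all
allTrue-sound (suc n) f all (true ∷ ρ)  = allTrue-sound n _ (proj₁ (to T-∧ all)) ρ
allTrue-sound (suc n) f all (false ∷ ρ) = allTrue-sound n _ (proj₂ (to T-∧ all)) ρ

Valid : ∀ {n} → Schema n → Set
Valid {n} φ = T (allTrue n ⟦ φ ⟧ᵇ)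

-- Once φ is concrete, Valid φ computes to ⊤ and the implicit proof is found by eta.
tautology : ∀ {n} (φ : Schema n) {valid : Valid φ} (σ : Vec Fm n) → ⊢ instantiate φ σ
tautology φ {valid} σ = taut λ v →
  trans (eval-instantiate v φ σ) (to T-≡ (allTrue-sound _ ⟦ φ ⟧ᵇ valid (map (eval v) σ)))

⇒-trans : ∀ {X Y Z} → ⊢ X ⇒ Y → ⊢ Y ⇒ Z → ⊢ X ⇒ Z
⇒-trans {X} {Y} {Z} X⇒Y Y⇒Z =
  mp (mp (tautology ((p ⇒ˢ q) ⇒ˢ (q ⇒ˢ r) ⇒ˢ p ⇒ˢ r) (X ∷ Y ∷ Z ∷ [])) X⇒Y) Y⇒Z

⇒-const : ∀ {H X} → ⊢ X → ⊢ H ⇒ X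
⇒-const {H} {X} x = mp (tautology (p ⇒ˢ q ⇒ˢ p) (X ∷ H ∷ [])) x

⇒-combine : ∀ {H X Y Z} → ⊢ X ∧' Y ⇒ Z → ⊢ H ⇒ X → ⊢ H ⇒ Y → ⊢ H ⇒ Z
⇒-combine {H} {X} {Y} {Z} X∧Y⇒Z H⇒X H⇒Y =
  mp (mp (mp (tautology ((p ∧ˢ q ⇒ˢ r) ⇒ˢ (s ⇒ˢ p) ⇒ˢ (s ⇒ˢ q) ⇒ˢ s ⇒ˢ r)
                        (X ∷ Y ∷ Z ∷ H ∷ []))
             X∧Y⇒Z) H⇒X) H⇒Y

□-mono : ∀ a {X Y} → ⊢ X ⇒ Y → ⊢ □⟨ a ⟩ X ⇒ □⟨ a ⟩ Y
□-mono a {X} {Y} X⇒Y = mp (K a X Y) (nec a X⇒Y)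

□-mono₂ : ∀ a {X Y Z} → ⊢ X ⇒ Y ⇒ Z → ⊢ □⟨ a ⟩ X ⇒ □⟨ a ⟩ Y ⇒ □⟨ a ⟩ Z
□-mono₂ a {X} {Y} {Z} X⇒Y⇒Z = ⇒-trans (□-mono a X⇒Y⇒Z) (K a Y Z)

□-mono₃ : ∀ a {X Y Z W} → ⊢ X ⇒ Y ⇒ Z ⇒ W →
          ⊢ □⟨ a ⟩ X ⇒ □⟨ a ⟩ Y ⇒ □⟨ a ⟩ Z ⇒ □⟨ a ⟩ W
□-mono₃ a {X} {Y} {Z} {W} X⇒Y⇒Z⇒W =
  mp (mp (tautology ((p ⇒ˢ q ⇒ˢ r) ⇒ˢ (r ⇒ˢ s) ⇒ˢ p ⇒ˢ q ⇒ˢ s)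
                    (□⟨ a ⟩ X ∷ □⟨ a ⟩ Y ∷ □⟨ a ⟩ (Z ⇒ W) ∷ (□⟨ a ⟩ Z ⇒ □⟨ a ⟩ W) ∷ []))
         (□-mono₂ a X⇒Y⇒Z⇒W))
     (K a Z W)

▷-intro : ∀ a {X Y} → ⊢ X ⇒ Y → ⊢ X ▷⟨ a ⟩ Y
▷-intro a {X} {Y} X⇒Y = mp (J1 a X Y) (nec a X⇒Y)

module _ (a : Label) (A B : Fm) where

  private
    D θ : Fm
    D = B ∧' □ (¬' A)
    θ = ◇ A ⇒ ◇⟨ a ⟩ D

  □θ⇒◇B⇒◇D : ⊢ □⟨ a ⟩ θ ⇒ ◇⟨ a ⟩ B ⇒ ◇⟨ a ⟩ D
  □θ⇒◇B⇒◇D =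
    mp (mp (tautology ((p ⇒ˢ q ⇒ˢ r ⇒ˢ s) ⇒ˢ (r ⇒ˢ q) ⇒ˢ p ⇒ˢ ¬ˢ s ⇒ˢ ¬ˢ r)
                      (□⟨ a ⟩ θ ∷ □⟨ a ⟩ □⟨ a ⟩ (¬' D) ∷ □⟨ a ⟩ (¬' D) ∷ □⟨ a ⟩ (¬' B) ∷ []))
           (□-mono₃ a θ⇒□¬D⇒¬D⇒¬B))
       (Four a a (¬' D))
    where
    θ⇒□¬D⇒¬D⇒¬B : ⊢ θ ⇒ □⟨ a ⟩ (¬' D) ⇒ ¬' D ⇒ ¬' B
    θ⇒□¬D⇒¬D⇒¬B = tautology ((¬ˢ q ⇒ˢ ¬ˢ r) ⇒ˢ r ⇒ˢ ¬ˢ (p ∧ˢ q) ⇒ˢ ¬ˢ p)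
                            (B ∷ □ (¬' A) ∷ □⟨ a ⟩ (¬' D) ∷ [])

  ▷⇒□θ⇒θ : ⊢ A ▷⟨ a ⟩ B ⇒ □⟨ a ⟩ θ ⇒ θ
  ▷⇒□θ⇒θ =
    mp (mp (tautology ((p ⇒ˢ q ⇒ˢ r) ⇒ˢ (s ⇒ˢ r ⇒ˢ t) ⇒ˢ p ⇒ˢ s ⇒ˢ q ⇒ˢ t)
                      (A ▷⟨ a ⟩ B ∷ ◇ A ∷ ◇⟨ a ⟩ B ∷ □⟨ a ⟩ θ ∷ ◇⟨ a ⟩ D ∷ []))
           (J4 a A B))
       □θ⇒◇B⇒◇D

  □▷⇒□θ : ⊢ □⟨ a ⟩ (A ▷⟨ a ⟩ B) ⇒ □⟨ a ⟩ θ
  □▷⇒□θ = ⇒-trans (□-mono a ▷⇒□θ⇒θ) (Löb a θ)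

  □θ⇒B▷D : ⊢ □⟨ a ⟩ θ ⇒ B ▷⟨ a ⟩ D
  □θ⇒B▷D =
    ⇒-combine (J2 a B (D ∨' E) D)
              (⇒-const (▷-intro ∅ (tautology (p ⇒ˢ p ∧ˢ q ∨ˢ p ∧ˢ ¬ˢ q) (B ∷ □ (¬' A) ∷ []))))
              (⇒-combine (J3 a D E D)
                         (⇒-const (▷-intro a (tautology (p ⇒ˢ p) (D ∷ []))))
                         □θ⇒E▷D)
    where
    E : Fm
    E = B ∧' ◇ A

    □θ⇒E▷D : ⊢ □⟨ a ⟩ θ ⇒ E ▷⟨ a ⟩ D
    □θ⇒E▷D = ⇒-trans (□-mono a (tautology ((¬ˢ q ⇒ˢ r) ⇒ˢ p ∧ˢ ¬ˢ q ⇒ˢ r)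
                                          (B ∷ □ (¬' A) ∷ ◇⟨ a ⟩ D ∷ [])))
                     (⇒-trans (J1 a E (◇⟨ a ⟩ D)) (J5 a a E D))

  □▷⇒W : ⊢ □⟨ a ⟩ (A ▷⟨ a ⟩ B) ⇒ A ▷ B ⇒ A ▷⟨ a ⟩ D
  □▷⇒W =
    mp (mp (tautology ((p ⇒ˢ q) ⇒ˢ (r ∧ˢ q ⇒ˢ s) ⇒ˢ p ⇒ˢ r ⇒ˢ s)
                      (□⟨ a ⟩ (A ▷⟨ a ⟩ B) ∷ B ▷⟨ a ⟩ D ∷ A ▷ B ∷ A ▷⟨ a ⟩ D ∷ []))
           (⇒-trans □▷⇒□θ □θ⇒B▷D))
       (J2 a A B D)

⊔-bound : ∀ {P Q : Set} {n x y} → (P → n ≤ x) → (Q → n ≤ y) → P ⊎ Q → n ≤ x ⊔ y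
⊔-bound {x = x} {y} P⇒n≤x Q⇒n≤y = [ m≤n⇒m≤n⊔o y ∘ P⇒n≤x , m≤n⇒m≤o⊔n x ∘ Q⇒n≤y ]

maxVarˢ : Seq → ℕ
maxVarˢ ε          = 0
maxVarˢ (a ▸ kv m) = maxVarˢ a ⊔ m
maxVarˢ (a ▸ idt)  = maxVarˢ a

maxVar : Fm → ℕ
maxVar (pv _)       = 0
maxVar ⊤'           = 0
maxVar ⊥'           = 0
maxVar (¬' A)       = maxVar A
maxVar (A ∧' B)     = maxVar A ⊔ maxVar B
maxVar (A ∨' B)     = maxVar A ⊔ maxVar B
maxVar (A ⇒ B)      = maxVar A ⊔ maxVar B
maxVar (□⟨ a ⟩ A)   = maxVarˢ (seq a) ⊔ maxVar A
maxVar (A ▷⟨ a ⟩ B) = maxVarˢ (seq a) ⊔ (maxVar A ⊔ maxVar B)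

OccS⇒≤maxVarˢ : ∀ {n} a → OccS n a → n ≤ maxVarˢ a
OccS⇒≤maxVarˢ ε          ()
OccS⇒≤maxVarˢ (a ▸ kv m) = ⊔-bound (OccS⇒≤maxVarˢ a) λ { refl → ≤-refl }
OccS⇒≤maxVarˢ (a ▸ idt)  = [ OccS⇒≤maxVarˢ a , (λ ()) ]

Occ⇒≤maxVar : ∀ {n} A → Occ n A → n ≤ maxVar A
Occ⇒≤maxVar (pv _)       ()
Occ⇒≤maxVar ⊤'           ()
Occ⇒≤maxVar ⊥'           ()
Occ⇒≤maxVar (¬' A)       = Occ⇒≤maxVar A
Occ⇒≤maxVar (A ∧' B)     = ⊔-bound (Occ⇒≤maxVar A) (Occ⇒≤maxVar B)
Occ⇒≤maxVar (A ∨' B)     = ⊔-bound (Occ⇒≤maxVar A) (Occ⇒≤maxVar B)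
Occ⇒≤maxVar (A ⇒ B)      = ⊔-bound (Occ⇒≤maxVar A) (Occ⇒≤maxVar B)
Occ⇒≤maxVar (□⟨ a ⟩ A)   = ⊔-bound (OccS⇒≤maxVarˢ (seq a)) (Occ⇒≤maxVar A)
Occ⇒≤maxVar (A ▷⟨ a ⟩ B) =
  ⊔-bound (OccS⇒≤maxVarˢ (seq a)) (⊔-bound (Occ⇒≤maxVar A) (Occ⇒≤maxVar B))

fresh : Fm → ℕ
fresh A = suc (maxVar A)

fresh-∉ : ∀ A → ¬ Occ (fresh A) A
fresh-∉ A = 1+n≰n ∘ Occ⇒≤maxVar A

P-single-side : ∀ a b k (k∉a : ¬ OccS k (seq a)) {A B C E F} →
                ¬ Occ k A → ¬ Occ k B → ¬ Occ k C →
                ⊢ (E ▷⟨ ext a (kv k) k∉a ⟩ F ⇒ E ▷⟨ a ⟩ F) ⇒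
                  □⟨ b ⟩ (A ▷⟨ ext a (kv k) k∉a ⟩ B) ⇒ C →
                ⊢ A ▷⟨ a ⟩ B ⇒ C
P-single-side a b k k∉a {A} {B} {C} {E} {F} k∉A k∉B k∉C premise =
  mp (tautology ((p ∧ˢ ⊤ˢ ⇒ˢ q) ⇒ˢ p ⇒ˢ q) (A ▷⟨ a ⟩ B ∷ C ∷ []))
     (P a b k [] (δ ∷ []) A B C k∉a [] k∉A k∉B k∉C (side▷ E F ∷ [])
        (mp (tautology ((p ⇒ˢ q ⇒ˢ r) ⇒ˢ p ∧ˢ q ∧ˢ ⊤ˢ ⇒ˢ r)
                       (δ ∷ □⟨ b ⟩ (A ▷⟨ ext a (kv k) k∉a ⟩ B) ∷ C ∷ []))
            premise))
  where
  δ : Fm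
  δ = E ▷⟨ ext a (kv k) k∉a ⟩ F ⇒ E ▷⟨ a ⟩ F

mainTheorem4 : (A B : Fm) → ⊢ ((A ▷ B) ⇒ (A ▷ (B ∧' □ (¬' A))))
mainTheorem4 A B =
  mp (tautology ((p ⇒ˢ p ⇒ˢ q) ⇒ˢ p ⇒ˢ q) (A ▷ B ∷ A ▷ D ∷ []))
     (P-single-side ∅ κ k (λ ()) (k∉C ∘ inj₁ ∘ inj₂ ∘ inj₁) (k∉C ∘ inj₁ ∘ inj₂ ∘ inj₂) k∉C
        (mp (tautology ((p ⇒ˢ q ⇒ˢ r) ⇒ˢ (r ⇒ˢ s) ⇒ˢ p ⇒ˢ q ⇒ˢ s)
                       (□⟨ κ ⟩ (A ▷⟨ κ ⟩ B) ∷ A ▷ B ∷ A ▷⟨ κ ⟩ D ∷ A ▷ D ∷ []))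
            (□▷⇒W κ A B)))
  where
  D C : Fm
  D = B ∧' □ (¬' A)
  C = A ▷ B ⇒ A ▷ D

  k : ℕ
  k = fresh C

  k∉C : ¬ Occ k C
  k∉C = fresh-∉ C

  κ : Label
  κ = ext ∅ (kv k) (λ ())
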